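{- Let $p\in\mathbb Z[x]$ be a nice antisymmetric polynomial of degree $d\ge3$ with center $C$, having at least two distinct roots. Let $m_0$ be the multiplicity of $C$ as a root of $p$, and let $g=\gcd(m_0,d)$. Then $m_0/g$ and $d/g$ are both squares of odd integers.
   Context: A polynomial $p\in\mathbb Z[x]$ of degree $d\ge2$ is nice if $p$ and its derivative $p'$ both factor as products of linear factors over $\mathbb Z$, i.e. $p(x)=c\prod_{i=1}^d(x-x_i)$ and $p'(x)=c'\prod_{j=1}^{d-1}(x-x'_j)$ with all $c,c',x_i,x'_j\in\mathbb Z$. A non-constant $p\in\mathbb Z[x]$ is antisymmetric if there is $C\in\mathbb Z$ (its center) with $p(C-a)=-p(C+a)$ for all $a\in\mathbb Z$ (so $C$ is a root of $p$). -}

module Defs where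

open import Data.Nat as ℕ using (ℕ; zero; suc; _<_; _≤_)
open import Data.Integer as ℤ using (ℤ; +_; _+_; _*_; -_; _-_)
open import Data.List using (List; []; _∷_; length)
open import Data.Product using (Σ; ∃; ∃-syntax; _×_)
open import Relation.Binary.PropositionalEquality using (_≡_; _≢_)
open import Relation.Nullary using (¬_)

-- Polynomials over ℤ as coefficient lists, constant coefficient first.
-- Trailing zeros allowed; equality of polynomials is coefficientwise (_≈ₚ_).
Poly : Set
Poly = List ℤ

coeff : Poly → ℕ → ℤ
coeff []       _       = + 0
coeff (a ∷ _)  zero    = a
coeff (_ ∷ p)  (suc n) = coeff p n

_≈ₚ_ : Poly → Poly → Set
p ≈ₚ q = ∀ n → coeff p n ≡ coeff q n

eval : Poly → ℤ → ℤ
eval []      _ = + 0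
eval (a ∷ p) x = a + x * eval p x

_+ₚ_ : Poly → Poly → Poly
[]      +ₚ q       = q
(a ∷ p) +ₚ []      = a ∷ p
(a ∷ p) +ₚ (b ∷ q) = (a + b) ∷ (p +ₚ q)

scale : ℤ → Poly → Poly
scale c []      = []
scale c (a ∷ p) = (c * a) ∷ scale c p

_*ₚ_ : Poly → Poly → Poly
[]      *ₚ q = []
(a ∷ p) *ₚ q = scale a q +ₚ (+ 0 ∷ (p *ₚ q))

oneₚ : Poly
oneₚ = + 1 ∷ []

lin : ℤ → Poly
lin a = (- a) ∷ + 1 ∷ []

prodLin : List ℤ → Poly
prodLin []       = oneₚ
prodLin (x ∷ xs) = lin x *ₚ prodLin xs

_^ₚ_ : Poly → ℕ → Poly
p ^ₚ zero  = oneₚ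
p ^ₚ suc n = p *ₚ (p ^ₚ n)

derivAux : ℕ → Poly → Poly
derivAux k []      = []
derivAux k (a ∷ p) = (+ k * a) ∷ derivAux (suc k) p

deriv : Poly → Poly
deriv []      = []
deriv (_ ∷ p) = derivAux 1 p

HasDegree : Poly → ℕ → Set
HasDegree p d = (coeff p d ≢ + 0) × (∀ n → d < n → coeff p n ≡ + 0)

SplitsOverℤ : Poly → ℕ → Set
SplitsOverℤ p k = ∃[ c ] ∃[ xs ] (length xs ≡ k × p ≈ₚ scale c (prodLin xs))

Nice : Poly → ℕ → Set
Nice p d = HasDegree p d × (2 ≤ d) × SplitsOverℤ p d × SplitsOverℤ (deriv p) (d ℕ.∸ 1)

-- antisymmetric with center C (non-constancy is supplied separately via the degree)
AntisymmetricAt : Poly → ℤ → Set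
AntisymmetricAt p C = ∀ a → eval p (C - a) ≡ - eval p (C + a)

_∣ₚ_ : Poly → Poly → Set
f ∣ₚ p = ∃[ q ] (p ≈ₚ (f *ₚ q))

RootMultiplicity : Poly → ℤ → ℕ → Set
RootMultiplicity p C m = ((lin C ^ₚ m) ∣ₚ p) × ¬ ((lin C ^ₚ suc m) ∣ₚ p)

Odd : ℕ → Set
Odd n = ∃[ k ] (n ≡ suc (2 ℕ.* k))

-- Write p = c (x - C)^k R(x) with R(C) ≠ 0, so that k = m₀. Antisymmetry about C gives
-- (-1)^k = -1 and makes R symmetric about C: k is odd, the roots of R pair off as w and
-- 2C - w, so deg R is even (hence d = k + deg R is odd) and |R(C)| = A² is a square.
-- The derivative is symmetric about C with leading coefficient d c, so it splits in the same
-- way as d c (x - C)^(k-1) R₂(x) with |R₂(C)| = B²; comparing this at C with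
-- p′ = (x - C)^(k-1) (k c R + (x - C) c R′) gives d B² = m₀ A². The quotients of m₀ and d
-- by their gcd are coprime with a ratio of squares, hence squares, and odd since m₀ and d are.
-- Without limits over ℤ, the derivative is handled as the divided difference
-- (p(x) - p(y)) / (x - y) at x = y, and identities between polynomial functions are
-- extended across finitely many points since a polynomial vanishing off a point vanishes there.

module Submission where

open import Defs

module OddSquares where

  open import Data.Nat
  open import Data.Nat.Properties
  open import Data.Nat.Divisibility using (divides; ∣-trans; ∣-antisym)
  open import Data.Nat.DivMod using (_/_; m/n*n≡m)
  open import Data.Nat.GCD using (gcd; gcd[m,n]∣m; gcd[m,n]∣n; gcd[m,n]≢0)
  open import Data.Nat.Coprimality as Coprime using (Coprime; coprime-divisor; coprime-/gcd)
  open import Data.Nat.Tactic.RingSolver using (solve-∀)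
  open import Data.Empty using (⊥-elim)
  open import Data.Product using (∃-syntax; _×_; _,_)
  open import Data.Sum using (_⊎_; inj₁; inj₂)
  open import Relation.Binary.PropositionalEquality
  open import Relation.Nullary using (¬_)

  Even : ℕ → Set
  Even n = ∃[ k ] (n ≡ 2 * k)

  even⊎odd : ∀ n → Even n ⊎ Odd n
  even⊎odd zero    = inj₁ (0 , refl)
  even⊎odd (suc n) with even⊎odd n
  ... | inj₁ (k , refl) = inj₂ (k , refl)
  ... | inj₂ (k , refl) = inj₁ (suc k , sym (*-suc 2 k))

  even⇒¬odd : ∀ {n} → Even n → ¬ Odd n
  even⇒¬odd (k , refl) (j , e) = even≢odd k j e

  odd⇒≢0 : ∀ {n} → Odd n → n ≢ 0
  odd⇒≢0 (k , refl) ()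

  even-suc-suc : ∀ {n} → Even n → Even (suc (suc n))
  even-suc-suc (k , refl) = suc k , sym (*-suc 2 k)

  even-*ʳ : ∀ {m} n → Even m → Even (m * n)
  even-*ʳ n (k , refl) = k * n , *-assoc 2 k n

  odd-*⇒odd : ∀ m n → Odd (m * n) → Odd m
  odd-*⇒odd m n mn-odd with even⊎odd m
  ... | inj₁ m-even = ⊥-elim (even⇒¬odd (even-*ʳ n m-even) mn-odd)
  ... | inj₂ m-odd  = m-odd

  odd+even : ∀ {m n} → Odd m → Even n → Odd (m + n)
  odd+even (j , refl) (k , refl) = j + k , cong suc (sym (*-distribˡ-+ 2 j k))

  *-cancelʳ-≢0 : ∀ m n {o} → o ≢ 0 → m * o ≡ n * o → m ≡ n
  *-cancelʳ-≢0 m n {o} o≢0 = *-cancelʳ-≡ m n o {{≢-nonZero o≢0}}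

  *-≢0 : ∀ {m n} → m ≢ 0 → n ≢ 0 → m * n ≢ 0
  *-≢0 {m} m≢0 n≢0 mn≡0 with m*n≡0⇒m≡0∨n≡0 m mn≡0
  ... | inj₁ m≡0 = m≢0 m≡0
  ... | inj₂ n≡0 = n≢0 n≡0

  gcd-cofactors : ∀ m n → m ≢ 0 → ∃[ m′ ] ∃[ n′ ] (Coprime m′ n′ × m ≡ m′ * gcd m n × n ≡ n′ * gcd m n)
  gcd-cofactors m n m≢0 =
    m / gcd m n , n / gcd m n , coprime-/gcd m n ,
    sym (m/n*n≡m (gcd[m,n]∣m m n)) , sym (m/n*n≡m (gcd[m,n]∣n m n))
    where
    instance
      gcd≢0 : NonZero (gcd m n)
      gcd≢0 = ≢-nonZero (gcd[m,n]≢0 m n (inj₁ m≢0))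

  coprime-* : ∀ {a b c} → Coprime a b → Coprime a c → Coprime a (b * c)
  coprime-* {a} {b} a⊥b a⊥c {e} (e∣a , e∣bc) = a⊥c (e∣a , coprime-divisor e⊥b e∣bc)
    where
    e⊥b : Coprime e b
    e⊥b (f∣e , f∣b) = a⊥b (∣-trans f∣e e∣a , f∣b)

  coprime-squares : ∀ {a b} → Coprime a b → Coprime (a * a) (b * b)
  coprime-squares {a} {b} a⊥b = Coprime.sym (coprime-* b²⊥a b²⊥a)
    where
    b²⊥a : Coprime (b * b) a
    b²⊥a = Coprime.sym (coprime-* a⊥b a⊥b)

  coprime-square-ratio-reduced : ∀ {m n A B} → Coprime m n → Coprime A B → A ≢ 0 →
    m * (A * A) ≡ n * (B * B) → m ≡ B * B × n ≡ A * A
  coprime-square-ratio-reduced {m} {n} {A} {B} m⊥n A⊥B A≢0 eq = m≡B² , sym A²≡n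
    where
    A²≡n : A * A ≡ n
    A²≡n = ∣-antisym
      (coprime-divisor (coprime-squares A⊥B) (divides m (trans (*-comm (B * B) n) (sym eq))))
      (coprime-divisor (Coprime.sym m⊥n) (divides (B * B) (trans eq (*-comm n (B * B)))))
    m≡B² : m ≡ B * B
    m≡B² = *-cancelʳ-≢0 m (B * B) (*-≢0 A≢0 A≢0)
      (trans eq (trans (cong (_* (B * B)) (sym A²≡n)) (*-comm (A * A) (B * B))))

  coprime-square-ratio : ∀ {m n} A B → Coprime m n → A ≢ 0 →
    m * (A * A) ≡ n * (B * B) → ∃[ a ] ∃[ b ] (m ≡ a * a × n ≡ b * b)
  coprime-square-ratio {m} {n} A B m⊥n A≢0 eq with gcd-cofactors A B A≢0
  ... | A′ , B′ , A′⊥B′ , A≡A′h , B≡B′h =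
    B′ , A′ , coprime-square-ratio-reduced m⊥n A′⊥B′ A′≢0 reduced
    where
    open ≡-Reasoning
    h : ℕ
    h = gcd A B
    A′≢0 : A′ ≢ 0
    A′≢0 A′≡0 = A≢0 (trans A≡A′h (cong (_* h) A′≡0))
    regroup : ∀ k a h → k * ((a * h) * (a * h)) ≡ k * (a * a) * (h * h)
    regroup = solve-∀
    reduced : m * (A′ * A′) ≡ n * (B′ * B′)
    reduced = *-cancelʳ-≢0 _ _ {h * h} (*-≢0 h≢0 h≢0) (begin
      m * (A′ * A′) * (h * h)   ≡⟨ regroup m A′ h ⟨
      m * ((A′ * h) * (A′ * h)) ≡⟨ cong (λ x → m * (x * x)) A≡A′h ⟨
      m * (A * A)               ≡⟨ eq ⟩
      n * (B * B)               ≡⟨ cong (λ x → n * (x * x)) B≡B′h ⟩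
      n * ((B′ * h) * (B′ * h)) ≡⟨ regroup n B′ h ⟩
      n * (B′ * B′) * (h * h)   ∎)
      where
      h≢0 : h ≢ 0
      h≢0 = gcd[m,n]≢0 A B (inj₁ A≢0)

  odd-square-quotients : ∀ {m n} A B → Odd m → Odd n → A ≢ 0 → n * (B * B) ≡ m * (A * A) →
    ∃[ a ] ∃[ b ] (Odd a × Odd b × m ≡ gcd m n * (a * a) × n ≡ gcd m n * (b * b))
  odd-square-quotients {m} {n} A B m-odd n-odd A≢0 eq with gcd-cofactors m n (odd⇒≢0 m-odd)
  ... | m′ , n′ , m′⊥n′ , m≡m′g , n≡n′g = conclude (coprime-square-ratio A B m′⊥n′ A≢0 reduced)
    where
    open ≡-Reasoning
    g : ℕ
    g = gcd m n
    swap : ∀ x y z → x * y * z ≡ x * z * y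
    swap = solve-∀
    reduced : m′ * (A * A) ≡ n′ * (B * B)
    reduced = *-cancelʳ-≢0 _ _ {g} (gcd[m,n]≢0 m n (inj₁ (odd⇒≢0 m-odd))) (begin
      m′ * (A * A) * g ≡⟨ swap m′ (A * A) g ⟩
      m′ * g * (A * A) ≡⟨ cong (_* (A * A)) m≡m′g ⟨
      m * (A * A)      ≡⟨ eq ⟨
      n * (B * B)      ≡⟨ cong (_* (B * B)) n≡n′g ⟩
      n′ * g * (B * B) ≡⟨ swap n′ g (B * B) ⟩
      n′ * (B * B) * g ∎)
    odd-square-part : ∀ {k k′} a → Odd k → k ≡ k′ * g → k′ ≡ a * a → Odd a × k ≡ g * (a * a)
    odd-square-part {k} a k-odd k≡k′g refl =
      odd-*⇒odd a a (odd-*⇒odd (a * a) g (subst Odd k≡k′g k-odd)) , trans k≡k′g (*-comm (a * a) g)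
    conclude : ∃[ a ] ∃[ b ] (m′ ≡ a * a × n′ ≡ b * b) →
               ∃[ a ] ∃[ b ] (Odd a × Odd b × m ≡ g * (a * a) × n ≡ g * (b * b))
    conclude (a , b , m′≡a² , n′≡b²) =
      let a-odd , m≡ga² = odd-square-part a m-odd m≡m′g m′≡a²
          b-odd , n≡gb² = odd-square-part b n-odd n≡n′g n′≡b²
      in a , b , a-odd , b-odd , m≡ga² , n≡gb²

module IntegerPolynomials where

  open OddSquares using (Even; even⊎odd; even-suc-suc; odd+even)
  open import Data.Nat as ℕ using (ℕ; zero; suc)
  import Data.Nat.Properties as ℕ
  open import Data.Integer using (ℤ; +_; -_; _+_; _-_; _*_; _^_; ∣_∣; 0ℤ; 1ℤ; -1ℤ; _≟_; ≢-nonZero)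
  open import Data.Integer.Properties
  open import Data.Integer.Tactic.RingSolver using (solve-∀)
  open import Algebra.Properties.CommutativeSemigroup *-commutativeSemigroup using (x∙yz≈y∙xz)
  open import Data.List using (List; []; _∷_; length)
  open import Data.List.Membership.Propositional using (_∈_)
  open import Data.List.Relation.Unary.Any using (here; there)
  open import Data.Empty using (⊥-elim)
  open import Data.Nat.Divisibility using (_∣_; divides; >⇒∤)
  open import Data.Product using (∃-syntax; _×_; _,_; proj₁; proj₂)
  open import Data.Sum using (inj₁; inj₂)
  open import Relation.Binary.PropositionalEquality
  open import Relation.Nullary using (yes; no)

  *-cancelˡ-≢0 : ∀ i {j k} → i ≢ 0ℤ → i * j ≡ i * k → j ≡ k
  *-cancelˡ-≢0 i {j} {k} i≢0 = *-cancelˡ-≡ i j k {{≢-nonZero i≢0}}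

  *-≢0 : ∀ {i j} → i ≢ 0ℤ → j ≢ 0ℤ → i * j ≢ 0ℤ
  *-≢0 {i} i≢0 j≢0 ij≡0 with i*j≡0⇒i≡0∨j≡0 i ij≡0
  ... | inj₁ i≡0 = i≢0 i≡0
  ... | inj₂ j≡0 = j≢0 j≡0

  *-≢0⇒≢0ˡ : ∀ i j → i * j ≢ 0ℤ → i ≢ 0ℤ
  *-≢0⇒≢0ˡ i j ij≢0 i≡0 = ij≢0 (trans (cong (_* j) i≡0) (*-zeroˡ j))

  *-≢0⇒≢0ʳ : ∀ i j → i * j ≢ 0ℤ → j ≢ 0ℤ
  *-≢0⇒≢0ʳ i j ij≢0 j≡0 = ij≢0 (trans (cong (i *_) j≡0) (*-zeroʳ i))

  i≢j⇒i-j≢0 : ∀ {i j} → i ≢ j → i - j ≢ 0ℤ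
  i≢j⇒i-j≢0 {i} {j} i≢j i-j≡0 = i≢j (i-j≡0⇒i≡j i j i-j≡0)

  ^-≢0 : ∀ {i} n → i ≢ 0ℤ → i ^ n ≢ 0ℤ
  ^-≢0 {i} n i≢0 iⁿ≡0 = i≢0 (i^n≡0⇒i≡0 i n iⁿ≡0)

  eval-+ₚ : ∀ f g x → eval (f +ₚ g) x ≡ eval f x + eval g x
  eval-+ₚ []      g       x = sym (+-identityˡ _)
  eval-+ₚ (a ∷ f) []      x = sym (+-identityʳ _)
  eval-+ₚ (a ∷ f) (b ∷ g) x rewrite eval-+ₚ f g x = regroup a b (eval f x) (eval g x) x
    where
    regroup : ∀ a b u v x → a + b + x * (u + v) ≡ a + x * u + (b + x * v)
    regroup = solve-∀

  eval-scale : ∀ c f x → eval (scale c f) x ≡ c * eval f x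
  eval-scale c []      x = sym (*-zeroʳ c)
  eval-scale c (a ∷ f) x rewrite eval-scale c f x = regroup c a (eval f x) x
    where
    regroup : ∀ c a u x → c * a + x * (c * u) ≡ c * (a + x * u)
    regroup = solve-∀

  eval-*ₚ : ∀ f g x → eval (f *ₚ g) x ≡ eval f x * eval g x
  eval-*ₚ []      g x = sym (*-zeroˡ (eval g x))
  eval-*ₚ (a ∷ f) g x
    rewrite eval-+ₚ (scale a g) (0ℤ ∷ (f *ₚ g)) x | eval-scale a g x | eval-*ₚ f g x
    = regroup a (eval f x) (eval g x) x
    where
    regroup : ∀ a u v x → a * v + (0ℤ + x * (u * v)) ≡ (a + x * u) * v
    regroup = solve-∀

  eval-oneₚ : ∀ x → eval oneₚ x ≡ 1ℤ
  eval-oneₚ x = cong (_+_ 1ℤ) (*-zeroʳ x)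

  eval-lin : ∀ a x → eval (lin a) x ≡ x - a
  eval-lin a x = regroup a x
    where
    regroup : ∀ a x → - a + x * (1ℤ + x * 0ℤ) ≡ x - a
    regroup = solve-∀

  eval-lin^ₚ : ∀ a n x → eval (lin a ^ₚ n) x ≡ (x - a) ^ n
  eval-lin^ₚ a zero    x = eval-oneₚ x
  eval-lin^ₚ a (suc n) x rewrite eval-*ₚ (lin a) (lin a ^ₚ n) x | eval-lin a x | eval-lin^ₚ a n x = refl

  eval-lin^ₚ-*ₚ : ∀ a m q x → eval ((lin a ^ₚ m) *ₚ q) x ≡ (x - a) ^ m * eval q x
  eval-lin^ₚ-*ₚ a m q x = trans (eval-*ₚ (lin a ^ₚ m) q x) (cong (_* eval q x) (eval-lin^ₚ a m x))

  eval-zero : ∀ f → (∀ n → coeff f n ≡ 0ℤ) → ∀ x → eval f x ≡ 0ℤ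
  eval-zero []      f≈0 x = refl
  eval-zero (a ∷ f) f≈0 x rewrite f≈0 0 | eval-zero f (λ n → f≈0 (suc n)) x =
    trans (+-identityˡ _) (*-zeroʳ x)

  eval-cong : ∀ f g → f ≈ₚ g → ∀ x → eval f x ≡ eval g x
  eval-cong []      g       f≈g x = sym (eval-zero g (λ n → sym (f≈g n)) x)
  eval-cong (a ∷ f) []      f≈g x = eval-zero (a ∷ f) f≈g x
  eval-cong (a ∷ f) (b ∷ g) f≈g x rewrite f≈g 0 | eval-cong f g (λ n → f≈g (suc n)) x = refl

  coeff-+ₚ : ∀ f g n → coeff (f +ₚ g) n ≡ coeff f n + coeff g n
  coeff-+ₚ []      g       n       = sym (+-identityˡ _)
  coeff-+ₚ (a ∷ f) []      n       = sym (+-identityʳ _)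
  coeff-+ₚ (a ∷ f) (b ∷ g) zero    = refl
  coeff-+ₚ (a ∷ f) (b ∷ g) (suc n) = coeff-+ₚ f g n

  coeff-scale : ∀ c f n → coeff (scale c f) n ≡ c * coeff f n
  coeff-scale c []      n       = sym (*-zeroʳ c)
  coeff-scale c (a ∷ f) zero    = refl
  coeff-scale c (a ∷ f) (suc n) = coeff-scale c f n

  coeff-lin*ₚ : ∀ a q n → coeff (lin a *ₚ q) (suc n) ≡ - a * coeff q (suc n) + coeff q n
  coeff-lin*ₚ a q n = begin
    coeff (lin a *ₚ q) (suc n)                                  ≡⟨ coeff-+ₚ (scale (- a) q) _ (suc n) ⟩
    coeff (scale (- a) q) (suc n) + coeff (scale 1ℤ q +ₚ (0ℤ ∷ [])) n
      ≡⟨ cong₂ _+_ (coeff-scale (- a) q (suc n)) (coeff-+ₚ (scale 1ℤ q) (0ℤ ∷ []) n) ⟩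
    - a * coeff q (suc n) + (coeff (scale 1ℤ q) n + coeff (0ℤ ∷ []) n)
      ≡⟨ cong (λ z → - a * coeff q (suc n) + z) (trans (cong₂ _+_ (coeff-scale 1ℤ q n) (coeff-singleton-0 n))
                                                       (trans (+-identityʳ _) (*-identityˡ (coeff q n)))) ⟩
    - a * coeff q (suc n) + coeff q n                           ∎
    where
    open ≡-Reasoning
    coeff-singleton-0 : ∀ n → coeff (0ℤ ∷ []) n ≡ 0ℤ
    coeff-singleton-0 zero    = refl
    coeff-singleton-0 (suc n) = refl

  coeff-prodLin-above : ∀ xs n → length xs ℕ.< n → coeff (prodLin xs) n ≡ 0ℤ
  coeff-prodLin-above []       (suc zero)    _ = refl
  coeff-prodLin-above []       (suc (suc n)) _ = refl
  coeff-prodLin-above (x ∷ xs) (suc n) (ℕ.s≤s len<n) = begin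
    coeff (prodLin (x ∷ xs)) (suc n)                        ≡⟨ coeff-lin*ₚ x (prodLin xs) n ⟩
    - x * coeff (prodLin xs) (suc n) + coeff (prodLin xs) n
      ≡⟨ cong₂ (λ u v → - x * u + v) (coeff-prodLin-above xs (suc n) (ℕ.m<n⇒m<1+n len<n))
                                      (coeff-prodLin-above xs n len<n) ⟩
    - x * 0ℤ + 0ℤ                                           ≡⟨ trans (+-identityʳ _) (*-zeroʳ (- x)) ⟩
    0ℤ                                                      ∎
    where open ≡-Reasoning

  coeff-prodLin-length : ∀ xs → coeff (prodLin xs) (length xs) ≡ 1ℤ
  coeff-prodLin-length []       = refl
  coeff-prodLin-length (x ∷ xs) = begin
    coeff (prodLin (x ∷ xs)) (suc (length xs))                          ≡⟨ coeff-lin*ₚ x (prodLin xs) (length xs) ⟩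
    - x * coeff (prodLin xs) (suc (length xs)) + coeff (prodLin xs) (length xs)
      ≡⟨ cong₂ (λ u v → - x * u + v) (coeff-prodLin-above xs (suc (length xs)) (ℕ.n<1+n (length xs)))
                                      (coeff-prodLin-length xs) ⟩
    - x * 0ℤ + 1ℤ                                                       ≡⟨ cong (_+ 1ℤ) (*-zeroʳ (- x)) ⟩
    1ℤ                                                                  ∎
    where open ≡-Reasoning

  coeff-derivAux : ∀ k f n → coeff (derivAux k f) n ≡ + (k ℕ.+ n) * coeff f n
  coeff-derivAux k []      n       = sym (*-zeroʳ (+ (k ℕ.+ n)))
  coeff-derivAux k (a ∷ f) zero    = cong (λ m → + m * a) (sym (ℕ.+-identityʳ k))
  coeff-derivAux k (a ∷ f) (suc n) =
    trans (coeff-derivAux (suc k) f n) (cong (λ m → + m * coeff f n) (sym (ℕ.+-suc k n)))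

  coeff-deriv : ∀ f n → coeff (deriv f) n ≡ + suc n * coeff f (suc n)
  coeff-deriv []      n = sym (*-zeroʳ (+ suc n))
  coeff-deriv (a ∷ f) n = coeff-derivAux 1 f n

  prodDiff : List ℤ → ℤ → ℤ
  prodDiff []       x = 1ℤ
  prodDiff (y ∷ ys) x = (x - y) * prodDiff ys x

  eval-prodLin : ∀ ys x → eval (prodLin ys) x ≡ prodDiff ys x
  eval-prodLin []       x = eval-oneₚ x
  eval-prodLin (y ∷ ys) x rewrite eval-*ₚ (lin y) (prodLin ys) x | eval-lin y x | eval-prodLin ys x = refl

  quotLin : Poly → ℤ → Poly
  quotLin []      y = []
  quotLin (a ∷ f) y = f +ₚ scale y (quotLin f y)

  eval-quotLin : ∀ f x y → eval f x - eval f y ≡ (x - y) * eval (quotLin f y) x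
  eval-quotLin []      x y = sym (*-zeroʳ (x - y))
  eval-quotLin (a ∷ f) x y
    rewrite eval-+ₚ f (scale y (quotLin f y)) x | eval-scale y (quotLin f y) x = begin
      a + x * eval f x - (a + y * eval f y)                    ≡⟨ split a x y (eval f x) (eval f y) ⟩
      (x - y) * eval f x + y * (eval f x - eval f y)           ≡⟨ cong (λ d → (x - y) * eval f x + y * d) (eval-quotLin f x y) ⟩
      (x - y) * eval f x + y * ((x - y) * Q)                   ≡⟨ collect x y (eval f x) Q ⟩
      (x - y) * (eval f x + y * Q)                             ∎
    where
    open ≡-Reasoning
    Q : ℤ
    Q = eval (quotLin f y) x
    split : ∀ a x y u v → a + x * u - (a + y * v) ≡ (x - y) * u + y * (u - v)
    split = solve-∀
    collect : ∀ x y u w → (x - y) * u + y * ((x - y) * w) ≡ (x - y) * (u + y * w)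
    collect = solve-∀

  -- Polynomial functions and the identity theorem

  Polynomial : (ℤ → ℤ) → Set
  Polynomial φ = ∃[ f ] (∀ x → eval f x ≡ φ x)

  polynomial-eval : ∀ f → Polynomial (eval f)
  polynomial-eval f = f , λ _ → refl

  polynomial-cong : ∀ {φ ψ} → (∀ x → φ x ≡ ψ x) → Polynomial φ → Polynomial ψ
  polynomial-cong φ≗ψ (f , f≗φ) = f , λ x → trans (f≗φ x) (φ≗ψ x)

  polynomial-const : ∀ c → Polynomial (λ _ → c)
  polynomial-const c = c ∷ [] , λ x → trans (cong (_+_ c) (*-zeroʳ x)) (+-identityʳ c)

  polynomial-id : Polynomial (λ x → x)
  polynomial-id = 0ℤ ∷ 1ℤ ∷ [] , regroup
    where
    regroup : ∀ x → 0ℤ + x * (1ℤ + x * 0ℤ) ≡ x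
    regroup = solve-∀

  polynomial-+ : ∀ {φ ψ} → Polynomial φ → Polynomial ψ → Polynomial (λ x → φ x + ψ x)
  polynomial-+ (f , f≗φ) (g , g≗ψ) = f +ₚ g , λ x → trans (eval-+ₚ f g x) (cong₂ _+_ (f≗φ x) (g≗ψ x))

  polynomial-* : ∀ {φ ψ} → Polynomial φ → Polynomial ψ → Polynomial (λ x → φ x * ψ x)
  polynomial-* (f , f≗φ) (g , g≗ψ) = f *ₚ g , λ x → trans (eval-*ₚ f g x) (cong₂ _*_ (f≗φ x) (g≗ψ x))

  polynomial-- : ∀ {φ ψ} → Polynomial φ → Polynomial ψ → Polynomial (λ x → φ x - ψ x)
  polynomial-- φ-poly (g , g≗ψ) =
    polynomial-+ φ-poly (scale -1ℤ g , λ x → trans (eval-scale -1ℤ g x) (trans (-1*i≡-i _) (cong -_ (g≗ψ x))))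

  polynomial-∘ : ∀ {φ ψ} → Polynomial ψ → Polynomial φ → Polynomial (λ x → ψ (φ x))
  polynomial-∘ {φ} (g , g≗ψ) φ-poly = polynomial-cong (λ x → g≗ψ (φ x)) (eval-∘ g)
    where
    eval-∘ : ∀ g → Polynomial (λ x → eval g (φ x))
    eval-∘ []      = polynomial-const 0ℤ
    eval-∘ (a ∷ g) = polynomial-+ (polynomial-const a) (polynomial-* φ-poly (eval-∘ g))

  polynomial-prodDiff : ∀ ys → Polynomial (prodDiff ys)
  polynomial-prodDiff ys = prodLin ys , eval-prodLin ys

  polynomial-lin^ : ∀ a n → Polynomial (λ x → (x - a) ^ n)
  polynomial-lin^ a n = lin a ^ₚ n , eval-lin^ₚ a n

  -- At t = a + (1 + ∣φ a∣) the factor theorem makes φ a a multiple of 1 + ∣φ a∣.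
  polynomial-zero-at : ∀ {φ} → Polynomial φ → ∀ a → (∀ x → x ≢ a → φ x ≡ 0ℤ) → φ a ≡ 0ℤ
  polynomial-zero-at {φ} (f , f≗φ) a φ≡0 = ∣i∣≡0⇒i≡0 (no-large-divisor n (divides ∣ Q ∣ ∣φa∣≡Q[1+n]))
    where
    n : ℕ
    n = ∣ φ a ∣
    t : ℤ
    t = a + + suc n
    shift : ∀ a b → a + b - a ≡ b
    shift = solve-∀
    t≢a : t ≢ a
    t≢a t≡a = ℕ.1+n≢0 (+-injective (trans (sym (shift a (+ suc n))) (i≡j⇒i-j≡0 t≡a)))
    Q : ℤ
    Q = eval (quotLin f a) t
    -φa≡[1+n]Q : - φ a ≡ + suc n * Q
    -φa≡[1+n]Q = begin
      - φ a               ≡⟨ +-identityˡ (- φ a) ⟨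
      0ℤ - φ a            ≡⟨ cong₂ _-_ (trans (f≗φ t) (φ≡0 t t≢a)) (f≗φ a) ⟨
      eval f t - eval f a ≡⟨ eval-quotLin f t a ⟩
      (t - a) * Q         ≡⟨ cong (_* Q) (shift a (+ suc n)) ⟩
      + suc n * Q         ∎
      where open ≡-Reasoning
    ∣φa∣≡Q[1+n] : n ≡ ∣ Q ∣ ℕ.* suc n
    ∣φa∣≡Q[1+n] = trans (sym (∣-i∣≡∣i∣ (φ a)))
      (trans (cong ∣_∣ -φa≡[1+n]Q) (trans (abs-* (+ suc n) Q) (ℕ.*-comm (suc n) ∣ Q ∣)))
    no-large-divisor : ∀ n → suc n ∣ n → n ≡ 0
    no-large-divisor zero    _       = refl
    no-large-divisor (suc n) [2+n]∣n = ⊥-elim (>⇒∤ (ℕ.n<1+n (suc n)) [2+n]∣n)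

  polynomial-≡-at : ∀ {φ ψ} → Polynomial φ → Polynomial ψ → ∀ a →
                    (∀ x → x ≢ a → φ x ≡ ψ x) → φ a ≡ ψ a
  polynomial-≡-at φ-poly ψ-poly a φ≡ψ = i-j≡0⇒i≡j _ _
    (polynomial-zero-at (polynomial-- φ-poly ψ-poly) a (λ x x≢a → i≡j⇒i-j≡0 (φ≡ψ x x≢a)))

  polynomial-≡ : ∀ {φ ψ} → Polynomial φ → Polynomial ψ → ∀ a →
                 (∀ x → x ≢ a → φ x ≡ ψ x) → ∀ x → φ x ≡ ψ x
  polynomial-≡ φ-poly ψ-poly a φ≡ψ x with x ≟ a
  ... | yes refl = polynomial-≡-at φ-poly ψ-poly a φ≡ψ
  ... | no x≢a   = φ≡ψ x x≢a

  polynomial-≡₂ : ∀ {φ ψ} → Polynomial φ → Polynomial ψ → ∀ a b →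
                  (∀ x → x ≢ a → x ≢ b → φ x ≡ ψ x) → ∀ x → φ x ≡ ψ x
  polynomial-≡₂ {φ} {ψ} φ-poly ψ-poly a b φ≡ψ = polynomial-≡ φ-poly ψ-poly a φ≡ψ-off-a
    where
    weighted : ∀ {χ} → Polynomial χ → Polynomial (λ x → (x - a) * χ x)
    weighted = polynomial-* (polynomial-- polynomial-id (polynomial-const a))
    weighted-≡ : ∀ x → x ≢ b → (x - a) * φ x ≡ (x - a) * ψ x
    weighted-≡ x x≢b with x ≟ a
    ... | yes refl = trans (cong (_* φ x) (+-inverseʳ x)) (sym (cong (_* ψ x) (+-inverseʳ x)))
    ... | no x≢a   = cong ((x - a) *_) (φ≡ψ x x≢a x≢b)
    φ≡ψ-off-a : ∀ x → x ≢ a → φ x ≡ ψ x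
    φ≡ψ-off-a x x≢a =
      *-cancelˡ-≢0 (x - a) (i≢j⇒i-j≢0 x≢a) (polynomial-≡ (weighted φ-poly) (weighted ψ-poly) b weighted-≡ x)

  -- Derivatives

  eval-derivAux-suc : ∀ k g x → eval (derivAux (suc k) g) x ≡ eval g x + eval (derivAux k g) x
  eval-derivAux-suc k []      x = refl
  eval-derivAux-suc k (b ∷ g) x rewrite eval-derivAux-suc (suc k) g x =
    regroup (+ k) b x (eval g x) (eval (derivAux (suc k) g) x)
    where
    regroup : ∀ k b x u v → (1ℤ + k) * b + x * (u + v) ≡ b + x * u + (k * b + x * v)
    regroup = solve-∀

  eval-derivAux-zero : ∀ g x → eval (derivAux 0 g) x ≡ x * eval (deriv g) x
  eval-derivAux-zero []      x = sym (*-zeroʳ x)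
  eval-derivAux-zero (b ∷ g) x = +-identityˡ _

  eval-deriv : ∀ f x → eval (deriv f) x ≡ eval (quotLin f x) x
  eval-deriv []      x = refl
  eval-deriv (a ∷ f) x
    rewrite eval-+ₚ f (scale x (quotLin f x)) x | eval-scale x (quotLin f x) x
          | eval-derivAux-suc 0 f x | eval-derivAux-zero f x | eval-deriv f x = refl

  eval-deriv-unique : ∀ f {H} → Polynomial H → ∀ y →
                      (∀ x → x ≢ y → (x - y) * H x ≡ eval f x - eval f y) → eval (deriv f) y ≡ H y
  eval-deriv-unique f H-poly y slope = trans (eval-deriv f y)
    (polynomial-≡-at (polynomial-eval (quotLin f y)) H-poly y λ x x≢y →
      *-cancelˡ-≢0 (x - y) (i≢j⇒i-j≢0 x≢y) (trans (sym (eval-quotLin f x y)) (sym (slope x x≢y))))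

  eval-deriv-cong : ∀ f g → (∀ x → eval f x ≡ eval g x) → ∀ y → eval (deriv f) y ≡ eval (deriv g) y
  eval-deriv-cong f g f≗g y =
    trans (eval-deriv-unique f (polynomial-eval (quotLin g y)) y λ x _ →
            trans (sym (eval-quotLin g x y)) (sym (cong₂ _-_ (f≗g x) (f≗g y))))
          (sym (eval-deriv g y))

  eval-deriv-*ₚ : ∀ f g y →
    eval (deriv (f *ₚ g)) y ≡ eval (deriv f) y * eval g y + eval f y * eval (deriv g) y
  eval-deriv-*ₚ f g y = trans (eval-deriv-unique (f *ₚ g) H-poly y slope)
    (sym (cong₂ (λ u v → u * eval g y + eval f y * v) (eval-deriv f y) (eval-deriv g y)))
    where
    H : ℤ → ℤ
    H x = eval (quotLin f y) x * eval g x + eval f y * eval (quotLin g y) x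
    H-poly : Polynomial H
    H-poly = polynomial-+ (polynomial-* (polynomial-eval (quotLin f y)) (polynomial-eval g))
                          (polynomial-* (polynomial-const (eval f y)) (polynomial-eval (quotLin g y)))
    leibniz : ∀ d a gx fy b fx gy → fx - fy ≡ d * a → gx - gy ≡ d * b →
              d * (a * gx + fy * b) ≡ fx * gx - fy * gy
    leibniz d a gx fy b fx gy Δf Δg = begin
      d * (a * gx + fy * b)       ≡⟨ expand d a gx fy b ⟩
      d * a * gx + fy * (d * b)   ≡⟨ cong₂ (λ u v → u * gx + fy * v) Δf Δg ⟨
      (fx - fy) * gx + fy * (gx - gy) ≡⟨ telescope fx fy gx gy ⟩
      fx * gx - fy * gy           ∎
      where
      open ≡-Reasoning
      expand : ∀ d a gx fy b → d * (a * gx + fy * b) ≡ d * a * gx + fy * (d * b)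
      expand = solve-∀
      telescope : ∀ fx fy gx gy → (fx - fy) * gx + fy * (gx - gy) ≡ fx * gx - fy * gy
      telescope = solve-∀
    slope : ∀ x → x ≢ y → (x - y) * H x ≡ eval (f *ₚ g) x - eval (f *ₚ g) y
    slope x _ rewrite eval-*ₚ f g x | eval-*ₚ f g y =
      leibniz (x - y) _ (eval g x) (eval f y) _ (eval f x) (eval g y) (eval-quotLin f x y) (eval-quotLin g x y)

  eval-deriv-lin : ∀ a y → eval (deriv (lin a)) y ≡ 1ℤ
  eval-deriv-lin a y = cong (_+_ 1ℤ) (*-zeroʳ y)

  eval-deriv-lin^ₚ : ∀ a j y → eval (deriv (lin a ^ₚ suc j)) y ≡ + suc j * (y - a) ^ j
  eval-deriv-lin^ₚ a zero y = begin
    eval (deriv (lin a *ₚ oneₚ)) y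
      ≡⟨ eval-deriv-*ₚ (lin a) oneₚ y ⟩
    eval (deriv (lin a)) y * eval oneₚ y + eval (lin a) y * 0ℤ
      ≡⟨ cong₂ (λ u v → u * v + eval (lin a) y * 0ℤ) (eval-deriv-lin a y) (eval-oneₚ y) ⟩
    1ℤ * 1ℤ + eval (lin a) y * 0ℤ
      ≡⟨ cong (_+_ 1ℤ) (*-zeroʳ (eval (lin a) y)) ⟩
    1ℤ ∎
    where open ≡-Reasoning
  eval-deriv-lin^ₚ a (suc j) y = begin
    eval (deriv (lin a *ₚ L)) y
      ≡⟨ eval-deriv-*ₚ (lin a) L y ⟩
    eval (deriv (lin a)) y * eval L y + eval (lin a) y * eval (deriv L) y
      ≡⟨ cong₂ (λ u v → u * eval L y + eval (lin a) y * v) (eval-deriv-lin a y) (eval-deriv-lin^ₚ a j y) ⟩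
    1ℤ * eval L y + eval (lin a) y * (+ suc j * (y - a) ^ j)
      ≡⟨ cong₂ (λ u v → 1ℤ * u + v * (+ suc j * (y - a) ^ j)) (eval-lin^ₚ a (suc j) y) (eval-lin a y) ⟩
    1ℤ * (y - a) ^ suc j + (y - a) * (+ suc j * (y - a) ^ j)
      ≡⟨ regroup (y - a) ((y - a) ^ j) (+ suc j) ⟩
    + suc (suc j) * (y - a) ^ suc j ∎
    where
    open ≡-Reasoning
    L : Poly
    L = lin a ^ₚ suc j
    regroup : ∀ u p k → 1ℤ * (u * p) + u * (k * p) ≡ (1ℤ + k) * (u * p)
    regroup = solve-∀

  eval-deriv-power-factor : ∀ f h a k → (∀ x → eval f x ≡ (x - a) ^ suc k * eval h x) → ∀ y →
    eval (deriv f) y ≡ (y - a) ^ k * (+ suc k * eval h y + (y - a) * eval (deriv h) y)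
  eval-deriv-power-factor f h a k f≗ y = begin
    eval (deriv f) y
      ≡⟨ eval-deriv-cong f (L *ₚ h) f≗Lh y ⟩
    eval (deriv (L *ₚ h)) y
      ≡⟨ eval-deriv-*ₚ L h y ⟩
    eval (deriv L) y * eval h y + eval L y * eval (deriv h) y
      ≡⟨ cong₂ (λ u v → u * eval h y + v * eval (deriv h) y) (eval-deriv-lin^ₚ a k y) (eval-lin^ₚ a (suc k) y) ⟩
    + suc k * (y - a) ^ k * eval h y + (y - a) ^ suc k * eval (deriv h) y
      ≡⟨ regroup (+ suc k) (y - a) ((y - a) ^ k) (eval h y) (eval (deriv h) y) ⟩
    (y - a) ^ k * (+ suc k * eval h y + (y - a) * eval (deriv h) y) ∎
    where
    open ≡-Reasoning
    L : Poly
    L = lin a ^ₚ suc k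
    f≗Lh : ∀ x → eval f x ≡ eval (L *ₚ h) x
    f≗Lh x = trans (f≗ x) (sym (eval-lin^ₚ-*ₚ a (suc k) h x))
    regroup : ∀ m u p v w → m * p * v + u * p * w ≡ p * (m * v + u * w)
    regroup = solve-∀

  SymmetricAbout : ℤ → (ℤ → ℤ) → Set
  SymmetricAbout C φ = ∀ a → φ (C + a) ≡ φ (C - a)

  polynomial-C+ : ∀ C → Polynomial (λ a → C + a)
  polynomial-C+ C = polynomial-+ (polynomial-const C) polynomial-id

  polynomial-C- : ∀ C → Polynomial (λ a → C - a)
  polynomial-C- C = polynomial-- (polynomial-const C) polynomial-id

  -- Antisymmetry makes the divided differences of p at (C + a, C + b) and at (C - a, C - b) equal;
  -- the derivative is their value on the diagonal a = b.
  antisymmetric⇒deriv-symmetric : ∀ p C → AntisymmetricAt p C → SymmetricAbout C (eval (deriv p))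
  antisymmetric⇒deriv-symmetric p C anti b =
    trans (eval-deriv p (C + b)) (trans (polynomial-≡-at φ-poly ψ-poly b φ≡ψ) (sym (eval-deriv p (C - b))))
    where
    φ ψ : ℤ → ℤ
    φ a = eval (quotLin p (C + b)) (C + a)
    ψ a = eval (quotLin p (C - b)) (C - a)
    φ-poly : Polynomial φ
    φ-poly = polynomial-∘ (polynomial-eval (quotLin p (C + b))) (polynomial-C+ C)
    ψ-poly : Polynomial ψ
    ψ-poly = polynomial-∘ (polynomial-eval (quotLin p (C - b))) (polynomial-C- C)
    translate : ∀ C a b → C + a - (C + b) ≡ a - b
    translate = solve-∀
    reflect : ∀ C a b q → (a - b) * q ≡ - ((C - a - (C - b)) * q)
    reflect = solve-∀
    negate : ∀ u v → - (- u - - v) ≡ u - v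
    negate = solve-∀
    φ≡ψ : ∀ a → a ≢ b → φ a ≡ ψ a
    φ≡ψ a a≢b = *-cancelˡ-≢0 (a - b) (i≢j⇒i-j≢0 a≢b) (trans Δφ (sym Δψ))
      where
      open ≡-Reasoning
      Δφ : (a - b) * φ a ≡ eval p (C + a) - eval p (C + b)
      Δφ = trans (cong (_* φ a) (sym (translate C a b))) (sym (eval-quotLin p (C + a) (C + b)))
      Δψ : (a - b) * ψ a ≡ eval p (C + a) - eval p (C + b)
      Δψ = begin
        (a - b) * ψ a                           ≡⟨ reflect C a b (ψ a) ⟩
        - ((C - a - (C - b)) * ψ a)             ≡⟨ cong -_ (eval-quotLin p (C - a) (C - b)) ⟨
        - (eval p (C - a) - eval p (C - b))     ≡⟨ cong₂ (λ u v → - (u - v)) (anti a) (anti b) ⟩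
        - (- eval p (C + a) - - eval p (C + b)) ≡⟨ negate (eval p (C + a)) (eval p (C + b)) ⟩
        eval p (C + a) - eval p (C + b)         ∎

  power-factor-shift : ∀ {F G : ℤ → ℤ} C a t → Polynomial F → Polynomial G → F C ≢ 0ℤ →
    (∀ x → (x - C) ^ a * F x ≡ (x - C) ^ (a ℕ.+ t) * G x) → t ≡ 0 × F C ≡ G C
  power-factor-shift {F} {G} C a t F-poly G-poly FC≢0 eq =
    at-C t (polynomial-≡-at F-poly (polynomial-* (polynomial-lin^ C t) G-poly) C off-C)
    where
    off-C : ∀ x → x ≢ C → F x ≡ (x - C) ^ t * G x
    off-C x x≢C = *-cancelˡ-≢0 ((x - C) ^ a) (^-≢0 a (i≢j⇒i-j≢0 x≢C))
      (trans (eq x) (trans (cong (_* G x) (^-distribˡ-+-* (x - C) a t)) (*-assoc ((x - C) ^ a) ((x - C) ^ t) (G x))))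
    at-C : ∀ t → F C ≡ (C - C) ^ t * G C → t ≡ 0 × F C ≡ G C
    at-C zero    FC≡GC = refl , trans FC≡GC (*-identityˡ (G C))
    at-C (suc t) FC≡0  = ⊥-elim (FC≢0 (trans FC≡0 (cong (λ z → z * (C - C) ^ t * G C) (+-inverseʳ C))))

  power-factor-unique : ∀ {F G : ℤ → ℤ} C a b → Polynomial F → Polynomial G → F C ≢ 0ℤ → G C ≢ 0ℤ →
    (∀ x → (x - C) ^ a * F x ≡ (x - C) ^ b * G x) → a ≡ b × F C ≡ G C
  power-factor-unique {F} {G} C a b F-poly G-poly FC≢0 GC≢0 eq with ℕ.≤-total a b
  ... | inj₁ a≤b =
    let b∸a≡0 , FC≡GC = power-factor-shift C a (b ℕ.∸ a) F-poly G-poly FC≢0 λ x →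
          trans (eq x) (cong (λ n → (x - C) ^ n * G x) (sym (ℕ.m+[n∸m]≡n a≤b)))
    in ℕ.≤-antisym a≤b (ℕ.m∸n≡0⇒m≤n b∸a≡0) , FC≡GC
  ... | inj₂ b≤a =
    let a∸b≡0 , GC≡FC = power-factor-shift C b (a ℕ.∸ b) G-poly F-poly GC≢0 λ x →
          trans (sym (eq x)) (cong (λ n → (x - C) ^ n * F x) (sym (ℕ.m+[n∸m]≡n b≤a)))
    in ℕ.≤-antisym (ℕ.m∸n≡0⇒m≤n a∸b≡0) b≤a , sym GC≡FC

  ^-neg : ∀ a k → (- a) ^ k ≡ -1ℤ ^ k * a ^ k
  ^-neg a zero    = refl
  ^-neg a (suc k) rewrite ^-neg a k = regroup a (-1ℤ ^ k) (a ^ k)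
    where
    regroup : ∀ a σ p → - a * (σ * p) ≡ - 1ℤ * σ * (a * p)
    regroup = solve-∀

  power-factor-symmetry : ∀ {E R : ℤ → ℤ} C c k t → Polynomial R → c ≢ 0ℤ → R C ≢ 0ℤ →
    (∀ x → E x ≡ (x - C) ^ k * (c * R x)) → (∀ a → E (C + a) ≡ t * E (C - a)) →
    t * -1ℤ ^ k ≡ 1ℤ × SymmetricAbout C R
  power-factor-symmetry {E} {R} C c k t R-poly c≢0 RC≢0 E≡ E-sym = s≡1 , symmetric
    where
    s : ℤ
    s = t * -1ℤ ^ k
    translate : ∀ C a → C + a - C ≡ a
    translate = solve-∀
    reflect : ∀ C a → C - a - C ≡ - a
    reflect = solve-∀
    regroup₊ : ∀ p c r → p * (c * r) ≡ c * p * r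
    regroup₊ = solve-∀
    regroup₋ : ∀ t σ p c r → t * (σ * p * (c * r)) ≡ c * p * (t * σ * r)
    regroup₋ = solve-∀
    off-0 : ∀ a → a ≢ 0ℤ → R (C + a) ≡ s * R (C - a)
    off-0 a a≢0 = *-cancelˡ-≢0 (c * a ^ k) {R (C + a)} {s * R (C - a)} (*-≢0 c≢0 (^-≢0 k a≢0)) (begin
      c * a ^ k * R (C + a)                     ≡⟨ regroup₊ (a ^ k) c (R (C + a)) ⟨
      a ^ k * (c * R (C + a))                   ≡⟨ cong (λ z → z ^ k * (c * R (C + a))) (translate C a) ⟨
      (C + a - C) ^ k * (c * R (C + a))         ≡⟨ E≡ (C + a) ⟨
      E (C + a)                                 ≡⟨ E-sym a ⟩
      t * E (C - a)                             ≡⟨ cong (t *_) (E≡ (C - a)) ⟩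
      t * ((C - a - C) ^ k * (c * R (C - a)))   ≡⟨ cong (λ z → t * (z ^ k * (c * R (C - a)))) (reflect C a) ⟩
      t * ((- a) ^ k * (c * R (C - a)))         ≡⟨ cong (λ z → t * (z * (c * R (C - a)))) (^-neg a k) ⟩
      t * (-1ℤ ^ k * a ^ k * (c * R (C - a)))   ≡⟨ regroup₋ t (-1ℤ ^ k) (a ^ k) c (R (C - a)) ⟩
      c * a ^ k * (s * R (C - a))               ∎)
      where open ≡-Reasoning
    RC≡sRC : R C ≡ s * R C
    RC≡sRC = subst (λ z → R z ≡ s * R z) (+-identityʳ C)
      (polynomial-≡-at (polynomial-∘ R-poly (polynomial-C+ C))
                       (polynomial-* (polynomial-const s) (polynomial-∘ R-poly (polynomial-C- C))) 0ℤ off-0)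
    s≡1 : s ≡ 1ℤ
    s≡1 = sym (*-cancelˡ-≢0 (R C) RC≢0 (trans (*-identityʳ (R C)) (trans RC≡sRC (*-comm s (R C)))))
    symmetric : SymmetricAbout C R
    symmetric a with a ≟ 0ℤ
    ... | yes refl = refl
    ... | no a≢0   = trans (off-0 a a≢0) (trans (cong (_* R (C - a)) s≡1) (*-identityˡ (R (C - a))))

  coeff-zero : ∀ h → (∀ x → eval h x ≡ 0ℤ) → ∀ n → coeff h n ≡ 0ℤ
  coeff-zero []      h≡0 n       = refl
  coeff-zero (a ∷ h) h≡0 zero    = trans (sym (+-identityʳ a)) (h≡0 0ℤ)
  coeff-zero (a ∷ h) h≡0 (suc n) = coeff-zero h tail≡0 n
    where
    a≡0 : a ≡ 0ℤ
    a≡0 = coeff-zero (a ∷ h) h≡0 zero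
    tail≡0 : ∀ x → eval h x ≡ 0ℤ
    tail≡0 = polynomial-≡ (polynomial-eval h) (polynomial-const 0ℤ) 0ℤ λ x x≢0 →
      *-cancelˡ-≢0 x x≢0 (trans (sym (trans (cong (_+ x * eval h x) a≡0) (+-identityˡ _)))
                                 (trans (h≡0 x) (sym (*-zeroʳ x))))

  eval-injective : ∀ f g → (∀ x → eval f x ≡ eval g x) → f ≈ₚ g
  eval-injective f g f≗g n = i-j≡0⇒i≡j _ _ (trans (sym coeff-d) (coeff-zero d d≡0 n))
    where
    d : Poly
    d = f +ₚ scale -1ℤ g
    coeff-d : coeff d n ≡ coeff f n - coeff g n
    coeff-d = trans (coeff-+ₚ f (scale -1ℤ g) n)
                    (cong (_+_ (coeff f n)) (trans (coeff-scale -1ℤ g n) (-1*i≡-i (coeff g n))))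
    d≡0 : ∀ x → eval d x ≡ 0ℤ
    d≡0 x = trans (eval-+ₚ f (scale -1ℤ g) x)
           (trans (cong (_+_ (eval f x)) (trans (eval-scale -1ℤ g x) (-1*i≡-i (eval g x))))
                  (i≡j⇒i-j≡0 (f≗g x)))

  factor-theorem : ∀ q C → eval q C ≡ 0ℤ → ∀ x → eval q x ≡ (x - C) * eval (quotLin q C) x
  factor-theorem q C qC≡0 x =
    trans (sym (trans (cong (_-_ (eval q x)) qC≡0) (+-identityʳ (eval q x)))) (eval-quotLin q x C)

  lin^ₚ-∣ₚ-suc : ∀ p q C m → p ≈ₚ ((lin C ^ₚ m) *ₚ q) → eval q C ≡ 0ℤ → (lin C ^ₚ suc m) ∣ₚ p
  lin^ₚ-∣ₚ-suc p q C m p≈ qC≡0 = quotLin q C , eval-injective p ((lin C ^ₚ suc m) *ₚ quotLin q C) λ x → begin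
    eval p x                             ≡⟨ eval-cong p ((lin C ^ₚ m) *ₚ q) p≈ x ⟩
    eval ((lin C ^ₚ m) *ₚ q) x           ≡⟨ eval-lin^ₚ-*ₚ C m q x ⟩
    (x - C) ^ m * eval q x               ≡⟨ cong ((x - C) ^ m *_) (factor-theorem q C qC≡0 x) ⟩
    (x - C) ^ m * ((x - C) * Q x)        ≡⟨ regroup ((x - C) ^ m) (x - C) (Q x) ⟩
    (x - C) * (x - C) ^ m * Q x          ≡⟨ eval-lin^ₚ-*ₚ C (suc m) (quotLin q C) x ⟨
    eval ((lin C ^ₚ suc m) *ₚ quotLin q C) x ∎
    where
    open ≡-Reasoning
    Q : ℤ → ℤ
    Q = eval (quotLin q C)
    regroup : ∀ p u w → p * (u * w) ≡ u * p * w
    regroup = solve-∀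

  rootMultiplicity-unique : ∀ {F : ℤ → ℤ} p C m k → RootMultiplicity p C m → Polynomial F → F C ≢ 0ℤ →
    (∀ x → eval p x ≡ (x - C) ^ k * F x) → m ≡ k
  rootMultiplicity-unique p C m k ((q , p≈) , not-higher) F-poly FC≢0 p≡ with eval q C ≟ 0ℤ
  ... | yes qC≡0 = ⊥-elim (not-higher (lin^ₚ-∣ₚ-suc p q C m p≈ qC≡0))
  ... | no qC≢0  = proj₁ (power-factor-unique C m k (polynomial-eval q) F-poly qC≢0 FC≢0 λ x →
    trans (sym (trans (eval-cong p ((lin C ^ₚ m) *ₚ q) p≈ x) (eval-lin^ₚ-*ₚ C m q x))) (p≡ x))

  -- Root lists symmetric about a centre

  prodDiff-root : ∀ ws x → prodDiff ws x ≡ 0ℤ → x ∈ ws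
  prodDiff-root (w ∷ ws) x P≡0 with i*j≡0⇒i≡0∨j≡0 (x - w) P≡0
  ... | inj₁ x-w≡0 = here (i-j≡0⇒i≡j x w x-w≡0)
  ... | inj₂ rest≡0 = there (prodDiff-root ws x rest≡0)

  prodDiff-remove : ∀ {u ws} → u ∈ ws →
    ∃[ vs ] (length ws ≡ suc (length vs) × ∀ x → prodDiff ws x ≡ (x - u) * prodDiff vs x)
  prodDiff-remove {ws = w ∷ ws} (here refl) = ws , refl , λ x → refl
  prodDiff-remove {u} {w ∷ ws} (there u∈ws) with prodDiff-remove u∈ws
  ... | vs , len , ws≡ = w ∷ vs , cong suc len , λ x →
    trans (cong ((x - w) *_) (ws≡ x)) (x∙yz≈y∙xz (x - w) (x - u) (prodDiff vs x))

  prodDiff-split : ∀ C xs → ∃[ k ] ∃[ R ] (length xs ≡ k ℕ.+ length R × prodDiff R C ≢ 0ℤ ×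
                                         ∀ x → prodDiff xs x ≡ (x - C) ^ k * prodDiff R x)
  prodDiff-split C []       = 0 , [] , refl , (λ ()) , λ x → refl
  prodDiff-split C (y ∷ ys) with prodDiff-split C ys | y ≟ C
  ... | k , R , len , RC≢0 , ys≡ | yes refl =
    suc k , R , cong suc len , RC≢0 , λ x → trans (cong ((x - y) *_) (ys≡ x)) (sym (*-assoc (x - y) _ _))
  ... | k , R , len , RC≢0 , ys≡ | no y≢C =
    k , y ∷ R , trans (cong suc len) (sym (ℕ.+-suc k (length R))) ,
    *-≢0 (i≢j⇒i-j≢0 (λ C≡y → y≢C (sym C≡y))) RC≢0 ,
    λ x → trans (cong ((x - y) *_) (ys≡ x)) (x∙yz≈y∙xz (x - y) ((x - C) ^ k) (prodDiff R x))

  mirror : ℤ → ℤ → ℤ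
  mirror C w = C - (w - C)

  mirror-root : ∀ C w ws → w ≢ C → SymmetricAbout C (prodDiff (w ∷ ws)) → mirror C w ∈ ws
  mirror-root C w ws w≢C P-sym = not-head (prodDiff-root (w ∷ ws) (mirror C w) mirror-vanishes)
    where
    open ≡-Reasoning
    cancel : ∀ C w → C + (w - C) - w ≡ 0ℤ
    cancel = solve-∀
    double : ∀ w → + 2 * w ≡ w + w
    double = solve-∀
    collapse : ∀ C w → C - (w - C) + w ≡ + 2 * C
    collapse = solve-∀
    mirror-vanishes : prodDiff (w ∷ ws) (mirror C w) ≡ 0ℤ
    mirror-vanishes = trans (sym (P-sym (w - C))) (cong (_* prodDiff ws (C + (w - C))) (cancel C w))
    not-head : mirror C w ∈ w ∷ ws → mirror C w ∈ ws
    not-head (here mirror≡w) = ⊥-elim (w≢C (*-cancelˡ-≢0 (+ 2) (λ ()) (begin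
      + 2 * w          ≡⟨ double w ⟩
      w + w            ≡⟨ cong (_+ w) mirror≡w ⟨
      mirror C w + w   ≡⟨ collapse C w ⟩
      + 2 * C          ∎)))
    not-head (there mirror∈ws) = mirror∈ws

  symmetric-cancel-pair : ∀ C w ws vs → (∀ x → prodDiff ws x ≡ (x - mirror C w) * prodDiff vs x) →
    SymmetricAbout C (prodDiff (w ∷ ws)) → SymmetricAbout C (prodDiff vs)
  symmetric-cancel-pair C w ws vs ws≡ P-sym =
    polynomial-≡₂ (polynomial-∘ (polynomial-prodDiff vs) (polynomial-C+ C))
                  (polynomial-∘ (polynomial-prodDiff vs) (polynomial-C- C)) e (- e) off-±e
    where
    open ≡-Reasoning
    e : ℤ
    e = w - C
    R : ℤ → ℤ
    R = prodDiff vs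
    pair : ∀ x → prodDiff (w ∷ ws) x ≡ (x - w) * (x - mirror C w) * R x
    pair x = trans (cong ((x - w) *_) (ws≡ x)) (sym (*-assoc (x - w) (x - mirror C w) (R x)))
    pair₊ : ∀ C w a → (C + a - w) * (C + a - (C - (w - C))) ≡ (a - (w - C)) * (a + (w - C))
    pair₊ = solve-∀
    pair₋ : ∀ C w a → (C - a - w) * (C - a - (C - (w - C))) ≡ (a - (w - C)) * (a + (w - C))
    pair₋ = solve-∀
    off-±e : ∀ a → a ≢ e → a ≢ - e → R (C + a) ≡ R (C - a)
    off-±e a a≢e a≢-e = *-cancelˡ-≢0 ((a - e) * (a + e)) (*-≢0 (i≢j⇒i-j≢0 a≢e) a+e≢0) (begin
      (a - e) * (a + e) * R (C + a)                   ≡⟨ cong (_* R (C + a)) (pair₊ C w a) ⟨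
      (C + a - w) * (C + a - mirror C w) * R (C + a)  ≡⟨ pair (C + a) ⟨
      prodDiff (w ∷ ws) (C + a)                       ≡⟨ P-sym a ⟩
      prodDiff (w ∷ ws) (C - a)                       ≡⟨ pair (C - a) ⟩
      (C - a - w) * (C - a - mirror C w) * R (C - a)  ≡⟨ cong (_* R (C - a)) (pair₋ C w a) ⟩
      (a - e) * (a + e) * R (C - a)                   ∎)
      where
      a+e≢0 : a + e ≢ 0ℤ
      a+e≢0 a+e≡0 = a≢-e (i-j≡0⇒i≡j a (- e) (trans (cong (_+_ a) (neg-involutive e)) a+e≡0))

  ∣prodDiff-pair∣ : ∀ C w ws vs B → (∀ x → prodDiff ws x ≡ (x - mirror C w) * prodDiff vs x) →
    ∣ prodDiff vs C ∣ ≡ B ℕ.* B → ∣ prodDiff (w ∷ ws) C ∣ ≡ (∣ C - w ∣ ℕ.* B) ℕ.* (∣ C - w ∣ ℕ.* B)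
  ∣prodDiff-pair∣ C w ws vs B ws≡ ∣vs∣≡B² = begin
    ∣ (C - w) * prodDiff ws C ∣                         ≡⟨ cong (λ z → ∣ (C - w) * z ∣) (ws≡ C) ⟩
    ∣ (C - w) * ((C - mirror C w) * prodDiff vs C) ∣    ≡⟨ cong (λ z → ∣ (C - w) * (z * prodDiff vs C) ∣) (flip C w) ⟩
    ∣ (C - w) * (- (C - w) * prodDiff vs C) ∣           ≡⟨ abs-* (C - w) (- (C - w) * prodDiff vs C) ⟩
    ∣ C - w ∣ ℕ.* ∣ - (C - w) * prodDiff vs C ∣         ≡⟨ cong (∣ C - w ∣ ℕ.*_) (abs-* (- (C - w)) (prodDiff vs C)) ⟩
    ∣ C - w ∣ ℕ.* (∣ - (C - w) ∣ ℕ.* ∣ prodDiff vs C ∣) ≡⟨ cong₂ (λ u v → ∣ C - w ∣ ℕ.* (u ℕ.* v)) (∣-i∣≡∣i∣ (C - w)) ∣vs∣≡B² ⟩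
    ∣ C - w ∣ ℕ.* (∣ C - w ∣ ℕ.* (B ℕ.* B))             ≡⟨ ℕ.*-assoc ∣ C - w ∣ ∣ C - w ∣ (B ℕ.* B) ⟨
    ∣ C - w ∣ ℕ.* ∣ C - w ∣ ℕ.* (B ℕ.* B)               ≡⟨ ℕ.[m*n]*[o*p]≡[m*o]*[n*p] ∣ C - w ∣ ∣ C - w ∣ B B ⟩
    ∣ C - w ∣ ℕ.* B ℕ.* (∣ C - w ∣ ℕ.* B)               ∎
    where
    open ≡-Reasoning
    flip : ∀ C w → C - (C - (w - C)) ≡ - (C - w)
    flip = solve-∀

  symmetric-roots-pair-up : ∀ C n ws → length ws ℕ.≤ n → prodDiff ws C ≢ 0ℤ → SymmetricAbout C (prodDiff ws) →
    Even (length ws) × ∃[ A ] (∣ prodDiff ws C ∣ ≡ A ℕ.* A)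
  symmetric-roots-pair-up C n       []       _             _   _     = (0 , refl) , 1 , refl
  symmetric-roots-pair-up C (suc n) (w ∷ ws) (ℕ.s≤s len≤n) P≢0 P-sym =
    pair-up (prodDiff-remove (mirror-root C w ws w≢C P-sym))
    where
    w≢C : w ≢ C
    w≢C w≡C = *-≢0⇒≢0ˡ (C - w) (prodDiff ws C) P≢0 (i≡j⇒i-j≡0 (sym w≡C))
    pair-up : ∃[ vs ] (length ws ≡ suc (length vs) × ∀ x → prodDiff ws x ≡ (x - mirror C w) * prodDiff vs x) →
              Even (length (w ∷ ws)) × ∃[ A ] (∣ prodDiff (w ∷ ws) C ∣ ≡ A ℕ.* A)
    pair-up (vs , len , ws≡) =
      let vs-even , B , ∣vs∣≡B² = symmetric-roots-pair-up C n vs vs≤n vsC≢0 (symmetric-cancel-pair C w ws vs ws≡ P-sym)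
      in subst (λ l → Even (suc l)) (sym len) (even-suc-suc vs-even) ,
         ∣ C - w ∣ ℕ.* B , ∣prodDiff-pair∣ C w ws vs B ws≡ ∣vs∣≡B²
      where
      vs≤n : length vs ℕ.≤ n
      vs≤n = ℕ.≤-trans (ℕ.n≤1+n (length vs)) (subst (ℕ._≤ n) len len≤n)
      vsC≢0 : prodDiff vs C ≢ 0ℤ
      vsC≢0 = *-≢0⇒≢0ʳ (C - mirror C w) (prodDiff vs C)
        (subst (_≢ 0ℤ) (ws≡ C) (*-≢0⇒≢0ʳ (C - w) (prodDiff ws C) P≢0))

  -- Splittings centred at C

  record CenteredSplitting (p : Poly) (C : ℤ) (n : ℕ) : Set where
    field
      lead           : ℤ
      order          : ℕ
      rest           : List ℤ
      coeff≡lead     : coeff p n ≡ lead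
      n≡order+length : n ≡ order ℕ.+ length rest
      rest-C≢0       : prodDiff rest C ≢ 0ℤ
      eval-split     : ∀ x → eval p x ≡ (x - C) ^ order * (lead * prodDiff rest x)

  centeredSplitting : ∀ {p n} C → SplitsOverℤ p n → CenteredSplitting p C n
  centeredSplitting {p} {n} C (c , xs , len , p≈) with prodDiff-split C xs
  ... | k , R , len-split , RC≢0 , xs≡ = record
    { lead           = c
    ; order          = k
    ; rest           = R
    ; coeff≡lead     = begin
        coeff p n                           ≡⟨ p≈ n ⟩
        coeff (scale c (prodLin xs)) n      ≡⟨ coeff-scale c (prodLin xs) n ⟩
        c * coeff (prodLin xs) n            ≡⟨ cong (λ m → c * coeff (prodLin xs) m) len ⟨
        c * coeff (prodLin xs) (length xs)  ≡⟨ cong (c *_) (coeff-prodLin-length xs) ⟩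
        c * 1ℤ                              ≡⟨ *-identityʳ c ⟩
        c                                   ∎
    ; n≡order+length = trans (sym len) len-split
    ; rest-C≢0       = RC≢0
    ; eval-split     = λ x → begin
        eval p x                            ≡⟨ eval-cong p (scale c (prodLin xs)) p≈ x ⟩
        eval (scale c (prodLin xs)) x       ≡⟨ eval-scale c (prodLin xs) x ⟩
        c * eval (prodLin xs) x             ≡⟨ cong (c *_) (trans (eval-prodLin xs x) (xs≡ x)) ⟩
        c * ((x - C) ^ k * prodDiff R x)    ≡⟨ x∙yz≈y∙xz c ((x - C) ^ k) (prodDiff R x) ⟩
        (x - C) ^ k * (c * prodDiff R x)    ∎
    }
    where open ≡-Reasoning

  -1^n≡-1⇒odd : ∀ n → -1ℤ ^ n ≡ -1ℤ → Odd n
  -1^n≡-1⇒odd n eq with even⊎odd n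
  ... | inj₁ (j , refl) = ⊥-elim (1≢-1 (trans (sym (trans (sym (^-*-assoc -1ℤ 2 j)) (^-zeroˡ j))) eq))
    where
    1≢-1 : 1ℤ ≢ -1ℤ
    1≢-1 ()
  ... | inj₂ n-odd = n-odd

  module _ {p C n} (S : CenteredSplitting p C n) where

    open CenteredSplitting S

    splitting-symmetry : ∀ t → lead ≢ 0ℤ → (∀ a → eval p (C + a) ≡ t * eval p (C - a)) →
                         t * -1ℤ ^ order ≡ 1ℤ × SymmetricAbout C (prodDiff rest)
    splitting-symmetry t c≢0 = power-factor-symmetry C lead order t (polynomial-prodDiff rest) c≢0 rest-C≢0 eval-split

    antisymmetric-splitting : AntisymmetricAt p C → lead ≢ 0ℤ → Odd order × SymmetricAbout C (prodDiff rest)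
    antisymmetric-splitting anti c≢0 = -1^n≡-1⇒odd order sign≡-1 , proj₂ symmetry
      where
      p-antisym : ∀ a → eval p (C + a) ≡ -1ℤ * eval p (C - a)
      p-antisym a = begin
        eval p (C + a)         ≡⟨ neg-involutive (eval p (C + a)) ⟨
        - - eval p (C + a)     ≡⟨ cong -_ (anti a) ⟨
        - eval p (C - a)       ≡⟨ -1*i≡-i (eval p (C - a)) ⟨
        -1ℤ * eval p (C - a)   ∎
        where open ≡-Reasoning
      symmetry : -1ℤ * -1ℤ ^ order ≡ 1ℤ × SymmetricAbout C (prodDiff rest)
      symmetry = splitting-symmetry -1ℤ c≢0 p-antisym
      sign≡-1 : -1ℤ ^ order ≡ -1ℤ
      sign≡-1 = trans (sym (neg-involutive _)) (cong -_ (trans (sym (-1*i≡-i _)) (proj₁ symmetry)))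

    symmetric-splitting : SymmetricAbout C (eval p) → lead ≢ 0ℤ → SymmetricAbout C (prodDiff rest)
    symmetric-splitting p-sym c≢0 =
      proj₂ (splitting-symmetry 1ℤ c≢0 λ a → trans (p-sym a) (sym (*-identityˡ _)))

  module _ {p C n} (S : CenteredSplitting p C (suc n)) (S′ : CenteredSplitting (deriv p) C n) where

    private
      module S  = CenteredSplitting S
      module S′ = CenteredSplitting S′

    deriv-lead : S′.lead ≡ + suc n * S.lead
    deriv-lead = trans (sym S′.coeff≡lead) (trans (coeff-deriv p n) (cong (+ suc n *_) S.coeff≡lead))

    deriv-lead≢0 : S.lead ≢ 0ℤ → S′.lead ≢ 0ℤ
    deriv-lead≢0 c≢0 c′≡0 = *-≢0 {+ suc n} (λ ()) c≢0 (trans (sym deriv-lead) c′≡0)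

    -- Up to the factor lead, both sides are the value at C of p′ / (x - C)^j.
    deriv-splitting-at-center : ∀ j → S.order ≡ suc j → S.lead ≢ 0ℤ →
      + suc n * prodDiff S′.rest C ≡ + suc j * prodDiff S.rest C
    deriv-splitting-at-center j order≡ c≢0 = *-cancelˡ-≢0 S.lead c≢0 (begin
      S.lead * (+ suc n * R′ C)   ≡⟨ x∙yz≈y∙xz S.lead (+ suc n) (R′ C) ⟩
      + suc n * (S.lead * R′ C)   ≡⟨ *-assoc (+ suc n) S.lead (R′ C) ⟨
      + suc n * S.lead * R′ C     ≡⟨ cong (_* R′ C) deriv-lead ⟨
      S′.lead * R′ C              ≡⟨ proj₂ orders-agree ⟩
      G C                         ≡⟨ G-at-C ⟩
      + suc j * (S.lead * R C)    ≡⟨ x∙yz≈y∙xz (+ suc j) S.lead (R C) ⟩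
      S.lead * (+ suc j * R C)    ∎)
      where
      open ≡-Reasoning
      R R′ : ℤ → ℤ
      R = prodDiff S.rest
      R′ = prodDiff S′.rest
      h : Poly
      h = scale S.lead (prodLin S.rest)
      eval-h : ∀ x → eval h x ≡ S.lead * R x
      eval-h x = trans (eval-scale S.lead (prodLin S.rest) x) (cong (S.lead *_) (eval-prodLin S.rest x))
      p≡ : ∀ x → eval p x ≡ (x - C) ^ suc j * eval h x
      p≡ x = trans (S.eval-split x) (cong₂ (λ k v → (x - C) ^ k * v) order≡ (sym (eval-h x)))
      G : ℤ → ℤ
      G y = + suc j * eval h y + (y - C) * eval (deriv h) y
      G-poly : Polynomial G
      G-poly = polynomial-+ (polynomial-* (polynomial-const (+ suc j)) (polynomial-eval h))
                            (polynomial-* (polynomial-- polynomial-id (polynomial-const C)) (polynomial-eval (deriv h)))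
      G-at-C : G C ≡ + suc j * (S.lead * R C)
      G-at-C = begin
        + suc j * eval h C + (C - C) * eval (deriv h) C ≡⟨ cong (λ z → + suc j * eval h C + z * eval (deriv h) C) (+-inverseʳ C) ⟩
        + suc j * eval h C + 0ℤ                         ≡⟨ +-identityʳ _ ⟩
        + suc j * eval h C                              ≡⟨ cong (+ suc j *_) (eval-h C) ⟩
        + suc j * (S.lead * R C)                        ∎
      GC≢0 : G C ≢ 0ℤ
      GC≢0 GC≡0 = *-≢0 {+ suc j} (λ ()) (*-≢0 c≢0 S.rest-C≢0) (trans (sym G-at-C) GC≡0)
      orders-agree : S′.order ≡ j × S′.lead * R′ C ≡ G C
      orders-agree = power-factor-unique C S′.order j
        (polynomial-* (polynomial-const S′.lead) (polynomial-prodDiff S′.rest)) G-poly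
        (*-≢0 (deriv-lead≢0 c≢0) S′.rest-C≢0) GC≢0
        λ x → trans (sym (S′.eval-split x)) (eval-deriv-power-factor p h C j p≡ x)

    splitting-square-relation : AntisymmetricAt p C → S.lead ≢ 0ℤ →
      Odd S.order × Odd (suc n) × ∃[ A ] ∃[ B ] (A ≢ 0 × suc n ℕ.* (B ℕ.* B) ≡ S.order ℕ.* (A ℕ.* A))
    splitting-square-relation anti c≢0 =
      (k , order≡) , subst Odd (sym S.n≡order+length) (odd+even (k , order≡) R-even) ,
      A , B , A≢0 , square-relation
      where
      open ≡-Reasoning
      R R′ : ℤ → ℤ
      R = prodDiff S.rest
      R′ = prodDiff S′.rest
      symmetry : Odd S.order × SymmetricAbout C R
      symmetry = antisymmetric-splitting S anti c≢0
      k : ℕ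
      k = proj₁ (proj₁ symmetry)
      order≡ : S.order ≡ suc (2 ℕ.* k)
      order≡ = proj₂ (proj₁ symmetry)
      R-pairs : Even (length S.rest) × ∃[ A ] (∣ R C ∣ ≡ A ℕ.* A)
      R-pairs = symmetric-roots-pair-up C _ S.rest ℕ.≤-refl S.rest-C≢0 (proj₂ symmetry)
      R′-pairs : Even (length S′.rest) × ∃[ B ] (∣ R′ C ∣ ≡ B ℕ.* B)
      R′-pairs = symmetric-roots-pair-up C _ S′.rest ℕ.≤-refl S′.rest-C≢0
        (symmetric-splitting S′ (antisymmetric⇒deriv-symmetric p C anti) (deriv-lead≢0 c≢0))
      R-even : Even (length S.rest)
      R-even = proj₁ R-pairs
      A B : ℕ
      A = proj₁ (proj₂ R-pairs)
      B = proj₁ (proj₂ R′-pairs)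
      A≢0 : A ≢ 0
      A≢0 A≡0 = S.rest-C≢0 (∣i∣≡0⇒i≡0 (trans (proj₂ (proj₂ R-pairs)) (cong (ℕ._* A) A≡0)))
      square-relation : suc n ℕ.* (B ℕ.* B) ≡ S.order ℕ.* (A ℕ.* A)
      square-relation = begin
        suc n ℕ.* (B ℕ.* B)                ≡⟨ cong (suc n ℕ.*_) (proj₂ (proj₂ R′-pairs)) ⟨
        suc n ℕ.* ∣ R′ C ∣                  ≡⟨ abs-* (+ suc n) (R′ C) ⟨
        ∣ + suc n * R′ C ∣                  ≡⟨ cong ∣_∣ (deriv-splitting-at-center (2 ℕ.* k) order≡ c≢0) ⟩
        ∣ + suc (2 ℕ.* k) * R C ∣           ≡⟨ abs-* (+ suc (2 ℕ.* k)) (R C) ⟩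
        suc (2 ℕ.* k) ℕ.* ∣ R C ∣           ≡⟨ cong₂ ℕ._*_ (sym order≡) (proj₂ (proj₂ R-pairs)) ⟩
        S.order ℕ.* (A ℕ.* A)              ∎

  nice-antisymmetric-square-relation : ∀ p d C m₀ → Nice p d → AntisymmetricAt p C → RootMultiplicity p C m₀ →
    Odd m₀ × Odd d × ∃[ A ] ∃[ B ] (A ≢ 0 × d ℕ.* (B ℕ.* B) ≡ m₀ ℕ.* (A ℕ.* A))
  nice-antisymmetric-square-relation p (suc n) C m₀ (deg , ℕ.s≤s _ , p-splits , p′-splits) anti mult =
    subst (λ m → Odd m × Odd (suc n) × ∃[ A ] ∃[ B ] (A ≢ 0 × suc n ℕ.* (B ℕ.* B) ≡ m ℕ.* (A ℕ.* A)))
          (sym m₀≡order) (splitting-square-relation S S′ anti c≢0)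
    where
    S : CenteredSplitting p C (suc n)
    S = centeredSplitting C p-splits
    S′ : CenteredSplitting (deriv p) C n
    S′ = centeredSplitting C p′-splits
    module S = CenteredSplitting S
    c≢0 : S.lead ≢ 0ℤ
    c≢0 c≡0 = proj₁ deg (trans S.coeff≡lead c≡0)
    m₀≡order : m₀ ≡ S.order
    m₀≡order = rootMultiplicity-unique p C m₀ S.order mult
      (polynomial-* (polynomial-const S.lead) (polynomial-prodDiff S.rest)) (*-≢0 c≢0 S.rest-C≢0) S.eval-split

open IntegerPolynomials using (nice-antisymmetric-square-relation)
open OddSquares using (odd-square-quotients)
open import Data.Nat using (ℕ; _≤_; _*_)
open import Data.Nat.GCD using (gcd)
open import Data.Integer using (ℤ; +_)
open import Data.Product using (∃-syntax; _×_; _,_)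
open import Relation.Binary.PropositionalEquality using (_≡_; _≢_)

theorem5p1 : (p : Poly) (d : ℕ) (C : ℤ) (m₀ : ℕ) →
    Nice p d → 3 ≤ d → AntisymmetricAt p C →
    (∃[ r ] ∃[ s ] (r ≢ s × eval p r ≡ + 0 × eval p s ≡ + 0)) →
    RootMultiplicity p C m₀ →
    ∃[ a ] ∃[ b ] (Odd a × Odd b ×
      m₀ ≡ gcd m₀ d * (a * a) × d ≡ gcd m₀ d * (b * b))
theorem5p1 p d C m₀ nice _ anti _ multiplicity =
  let m₀-odd , d-odd , A , B , A≢0 , d·B²≡m₀·A² = nice-antisymmetric-square-relation p d C m₀ nice anti multiplicity
  in odd-square-quotients A B m₀-odd d-odd A≢0 d·B²≡m₀·A²
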